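{- Let $k$ be a positive integer. If $H$ is a $k$-uniform hypergraph with minimum degree at least $k/2+1$ and girth at least $5$, then $H$ is $k'$-detectable for every positive integer $k'\le k$.
   Context: A hypergraph is $k$-uniform if all hyperedges have cardinality $k$; the degree of a vertex is the number of hyperedges containing it. Girth is in the sense of Berge: a cycle of length $\ell\ge 2$ is a sequence of distinct vertices $v_1,\dots,v_\ell$ together with distinct hyperedges $e_1,\dots,e_\ell$ with $\{v_i,v_{i+1}\}\subseteq e_i$ for $1\le i\le \ell-1$ and $\{v_\ell,v_1\}\subseteq e_\ell$; the girth is the minimum length of a cycle. Hypergraph detection: for a hypergraph with hyperedges $h_1,\dots,h_g$ of cardinality at most $k$ and a set $B$ of $k'\le k$ vertices, the detection vector is $(p_1,\dots,p_g)$ with $p_i=0$ if $h_i\cap B=\emptyset$, $p_i=k$ if $|h_i\cap B|=k$, and $p_i=1$ otherwise. The hypergraph is $k'$-detectable if any two distinct $k'$-element vertex sets have distinct detection vectors. -}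

module Defs where

open import Data.Nat using (ℕ; zero; suc; _≤_; _*_; _+_)
open import Data.Nat using (_≡ᵇ_)
open import Data.Fin.Subset.Properties using (_∈?_)
open import Data.Bool using (Bool; true; false; if_then_else_)
open import Data.Fin using (Fin; zero; suc; inject₁; fromℕ)
open import Data.Fin.Subset using (Subset; _∈_; _∩_; ∣_∣)
open import Data.Vec using (Vec; tabulate)
open import Data.List using (List; length; filter)
open import Data.List.Base using (allFin)
open import Data.Product using (_×_)
open import Function.Definitions using (Injective)
open import Relation.Binary.PropositionalEquality using (_≡_; _≢_)
open import Relation.Nullary using (¬_)
open import Relation.Nullary.Decidable using (⌊_⌋)

record Hypergraph (n : ℕ) : Set where
  field
    g     : ℕ
    edge  : Fin g → Subset n

open Hypergraph public

Uniform : ∀ {n} → ℕ → Hypergraph n → Set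
Uniform k H = ∀ i → ∣ edge H i ∣ ≡ k

degree : ∀ {n} → Hypergraph n → Fin n → ℕ
degree H v = length (filter (λ i → v ∈? edge H i) (allFin (g H)))

-- Berge cycle of length suc m: distinct vertices v_0..v_m, distinct edges e_0..e_m,
-- consecutive vertices in the corresponding edge, and v_m, v_0 ∈ e_m.
record Cycle {n} (H : Hypergraph n) (m : ℕ) : Set where
  field
    vtx      : Fin (suc m) → Fin n
    edg      : Fin (suc m) → Fin (g H)
    vtx-inj  : Injective _≡_ _≡_ vtx
    edg-inj  : Injective _≡_ _≡_ edg
    step     : ∀ (i : Fin m) →
               (vtx (inject₁ i) ∈ edge H (edg (inject₁ i))) ×
               (vtx (suc i) ∈ edge H (edg (inject₁ i)))
    close    : (vtx (fromℕ m) ∈ edge H (edg (fromℕ m))) ×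
               (vtx zero ∈ edge H (edg (fromℕ m)))

-- girth at least 5: no cycle of length ℓ = suc m with 2 ≤ ℓ ≤ 4
GirthAtLeast5 : ∀ {n} → Hypergraph n → Set
GirthAtLeast5 H = ∀ m → 1 ≤ m → m ≤ 3 → ¬ Cycle H m

detValue : ∀ {n} → ℕ → Subset n → Subset n → ℕ
detValue k h B =
  if ∣ h ∩ B ∣ ≡ᵇ 0 then 0 else (if ∣ h ∩ B ∣ ≡ᵇ k then k else 1)

detVector : ∀ {n} → ℕ → (H : Hypergraph n) → Subset n → Vec ℕ (g H)
detVector k H B = tabulate (λ i → detValue k (edge H i) B)

Detectable : ∀ {n} → ℕ → ℕ → Hypergraph n → Set
Detectable k k' H = ∀ (B B' : Subset _) → ∣ B ∣ ≡ k' → ∣ B' ∣ ≡ k' → B ≢ B' →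
  detVector k H B ≢ detVector k H B'

module Submission where

-- Suppose B ≢ B' are k'-sets with the same detection vector.  Only its zero
-- entries are used: an edge meets B iff it meets B'.  Pick v ∈ B ∖ B' and
-- x ∈ B' ∖ B.  Girth at least 5 (no Berge 2-, 3- or 4-cycles) turns choices of
-- vertices along the edges at v and at x into two duplicate-free lists of
-- elements of B, of lengths deg v and deg x, with at most one common element.
-- Then deg v + deg x ≤ ∣ B ∣ + 1 ≤ k + 1, contradicting deg ≥ k/2 + 1.
--   * If on every edge at v the chosen B'-vertex also lies in B, these vertices
--     and the chosen B-vertices on the edges at x are the two lists; a second
--     common element would close a 4-cycle.
--   * Otherwise an edge e holds v and a vertex x of B' ∖ B.  A B'-vertex w ∉ B on
--     an edge at v is relayed to a B-vertex on a second edge through w; only the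
--     relay along e can meet the B-vertices on the edges at x.

open import Defs
open import Data.Nat using (ℕ; zero; suc; _≤_; _+_; _*_; s≤s; z≤n; _≡ᵇ_)
open import Data.Bool using (if_then_else_; true; false)
open import Data.Nat.Properties
  using (≤-trans; ≤-reflexive; ≤-total; +-monoʳ-≤; +-monoˡ-≤; +-identityʳ; +-suc; +-comm;
         *-cancelˡ-<; <⇒≢; m<n⇒n≢0; 1+n≰n; module ≤-Reasoning)
open import Data.Fin using (Fin; zero; suc; _≟_)
open import Data.Fin.Properties using (any?)
open import Data.Fin.Subset using (Subset; _∈_; _∉_; _∩_; _⊆_; ∣_∣; Nonempty)
open import Data.Fin.Subset.Properties
  using (_∈?_; nonempty?; Empty-unique; ∣⊥∣≡0; x∈p⇒∣p-x∣<∣p∣; x∈p∧x≢y⇒x∈p-y;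
         p⊂q⇒∣p∣<∣q∣; ⊆-antisym; x∈p∩q⁺; x∈p∩q⁻)
open import Data.List using (List; []; _∷_; length; map; filter; _++_; lookup; allFin)
open import Data.List.Properties using (length-++; length-map; filter-all)
open import Data.List.Relation.Unary.All as All using (All; []; _∷_)
open import Data.List.Relation.Unary.All.Properties as Allₚ using ()
open import Data.List.Relation.Unary.Any using (here; there)
open import Data.List.Relation.Unary.Unique.Propositional using (Unique; []; _∷_)
import Data.List.Relation.Unary.Unique.Propositional.Properties as Uniqueₚ
open import Data.List.Membership.Propositional using () renaming (_∈_ to _∈ˡ_)
import Data.List.Membership.DecPropositional as DecMembership
open import Data.List.Membership.Propositional.Properties
  using (∈-map⁻; ∈-filter⁻; ∈-lookup)
open import Data.Product using (_×_; _,_; proj₁; proj₂; ∃)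
open import Data.Sum using (_⊎_; inj₁; inj₂)
open import Data.Empty using (⊥; ⊥-elim)
import Data.Vec as Vec
open import Data.Vec.Properties using (lookup∘tabulate)
open import Relation.Binary.PropositionalEquality
  using (_≡_; _≢_; ≢-sym; refl; sym; trans; cong; cong₂; subst; module ≡-Reasoning)
open import Relation.Nullary using (¬_; Dec; yes; no; ¬?; contradiction)
open import Relation.Nullary.Decidable using (_×-dec_)
open import Relation.Unary using (Pred; Decidable)
open import Level using (0ℓ)


module _ {A : Set} where

  AtMostOneCommon : List A → List A → Set
  AtMostOneCommon xs ys = ∀ {y y'} → y ∈ˡ ys → y' ∈ˡ ys → y ∈ˡ xs → y' ∈ˡ xs → y ≡ y'

  -- Positions in a duplicate-free list are determined by their entries; this
  -- makes the vertex and edge sequences of explicit short cycles injective.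
  lookup-injective : ∀ {xs : List A} → Unique xs → ∀ {i j} → lookup xs i ≡ lookup xs j → i ≡ j
  lookup-injective (_ ∷ _) {zero} {zero} _ = refl
  lookup-injective (x∉ ∷ _) {zero} {suc j} eq = contradiction eq (All.lookup x∉ (∈-lookup j))
  lookup-injective (x∉ ∷ _) {suc i} {zero} eq = contradiction (sym eq) (All.lookup x∉ (∈-lookup i))
  lookup-injective (_ ∷ u) {suc i} {suc j} eq = cong suc (lookup-injective u eq)

module _ {A B : Set} where

  map-unique : ∀ (f : A → B) {xs} → (∀ {x y} → x ∈ˡ xs → y ∈ˡ xs → f x ≡ f y → x ≡ y) →
               Unique xs → Unique (map f xs)
  map-unique f {[]} _ [] = []
  map-unique f {x ∷ xs} inj (x∉ ∷ u) =
    Allₚ.map⁺ (All.tabulate λ y∈ fx≡fy → All.lookup x∉ y∈ (inj (here refl) (there y∈) fx≡fy))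
    ∷ map-unique f (λ x∈ y∈ → inj (there x∈) (there y∈)) u

avoid-one : ∀ {m} {xs : List (Fin m)} → Unique xs → 2 ≤ length xs → ∀ z → ∃ λ y → y ∈ˡ xs × y ≢ z
avoid-one {xs = _ ∷ []} _ (s≤s ())
avoid-one {xs = x ∷ x' ∷ _} ((x≢x' ∷ _) ∷ _) _ z with x ≟ z
... | yes refl = x' , there (here refl) , λ x'≡x → x≢x' (sym x'≡x)
... | no x≢z = x , here refl , x≢z

unique-within : ∀ {n} {S : Subset n} {xs : List (Fin n)} → Unique xs → All (_∈ S) xs → length xs ≤ ∣ S ∣
unique-within [] [] = z≤n
unique-within (x∉ ∷ u) (x∈S ∷ xs⊆S) =
  ≤-trans (s≤s (unique-within u (All.tabulate λ y∈ →
            x∈p∧x≢y⇒x∈p-y (All.lookup xs⊆S y∈) (λ y≡x → All.lookup x∉ y∈ (sym y≡x)))))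
          (x∈p⇒∣p-x∣<∣p∣ x∈S)

filter-out-one : ∀ {A : Set} {P : Pred A 0ℓ} (P? : Decidable P) {ys : List A} →
  (∀ {y y'} → y ∈ˡ ys → y' ∈ˡ ys → P y → P y' → y ≡ y') → Unique ys →
  length ys ≤ suc (length (filter (λ y → ¬? (P? y)) ys))
filter-out-one P? {[]} _ _ = z≤n
filter-out-one {P = P} P? {y ∷ ys} one (y∉ ∷ u) with P? y
... | yes Py = s≤s (≤-reflexive (cong length (sym (filter-all (λ z → ¬? (P? z)) rest-fails))))
  where
  rest-fails : All (λ z → ¬ P z) ys
  rest-fails = All.tabulate λ z∈ Pz → All.lookup y∉ z∈ (one (here refl) (there z∈) Py Pz)
... | no _ = s≤s (filter-out-one P? (λ y∈ y'∈ → one (there y∈) (there y'∈)) u)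

overlap-count : ∀ {n} {S : Subset n} {xs ys : List (Fin n)} → Unique xs → Unique ys →
  All (_∈ S) xs → All (_∈ S) ys → AtMostOneCommon xs ys → length xs + length ys ≤ suc ∣ S ∣
overlap-count {n} {S} {xs} {ys} uxs uys xs⊆S ys⊆S one = begin
  length xs + length ys          ≤⟨ +-monoʳ-≤ (length xs) (filter-out-one (_∈ˡ? xs) one uys) ⟩
  length xs + suc (length new)   ≡⟨ +-suc (length xs) (length new) ⟩
  suc (length xs + length new)   ≡⟨ cong suc (sym (length-++ xs)) ⟩
  suc (length (xs ++ new))       ≤⟨ s≤s (unique-within unique-union (Allₚ.++⁺ xs⊆S (Allₚ.filter⁺ _ ys⊆S))) ⟩
  suc ∣ S ∣                      ∎
  where
  open ≤-Reasoning
  _∈ˡ?_ : (y : Fin n) (zs : List (Fin n)) → Dec (y ∈ˡ zs)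
  _∈ˡ?_ = DecMembership._∈?_ _≟_
  new : List (Fin n)
  new = filter (λ y → ¬? (y ∈ˡ? xs)) ys
  unique-union : Unique (xs ++ new)
  unique-union = Uniqueₚ.++⁺ uxs (Uniqueₚ.filter⁺ _ uys)
    λ (y∈xs , y∈new) → proj₂ (∈-filter⁻ (λ y → ¬? (y ∈ˡ? xs)) {xs = ys} y∈new) y∈xs


double : ∀ c → 2 * c ≡ c + c
double c = cong (c +_) (+-identityʳ c)

half-sum : ∀ {m a b} → m ≤ 2 * a → m ≤ 2 * b → m ≤ a + b
half-sum {a = a} {b} m≤2a m≤2b with ≤-total a b
... | inj₁ a≤b = ≤-trans m≤2a (≤-trans (≤-reflexive (double a)) (+-monoʳ-≤ a a≤b))
... | inj₂ b≤a = ≤-trans m≤2b (≤-trans (≤-reflexive (double b)) (+-monoˡ-≤ b b≤a))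

two-from-double : ∀ {k d} → 1 ≤ k → k + 2 ≤ 2 * d → 2 ≤ d
two-from-double {k} {d} k≥1 bound = *-cancelˡ-< 2 1 d (≤-trans (+-monoˡ-≤ 2 k≥1) bound)


module _ {n : ℕ} where

  -- An element of p, chosen whenever p is nonempty (d is returned otherwise).
  choose : Fin n → Subset n → Fin n
  choose d p with nonempty? p
  ... | yes (a , _) = a
  ... | no _ = d

  choose-∈ : ∀ d {p} → Nonempty p → choose d p ∈ p
  choose-∈ d {p} ne with nonempty? p
  ... | yes (_ , a∈p) = a∈p
  ... | no empty = contradiction ne empty

  nonempty⇒size≢0 : ∀ {p : Subset n} → Nonempty p → ∣ p ∣ ≢ 0
  nonempty⇒size≢0 (a , a∈p) = m<n⇒n≢0 (x∈p⇒∣p-x∣<∣p∣ a∈p)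

  size≢0⇒nonempty : ∀ {p : Subset n} → ∣ p ∣ ≢ 0 → Nonempty p
  size≢0⇒nonempty {p} size≢0 with nonempty? p
  ... | yes ne = ne
  ... | no empty = contradiction (trans (cong ∣_∣ (Empty-unique empty)) (∣⊥∣≡0 n)) size≢0

  ∈∉⇒≢ : ∀ {a b} {S : Subset n} → a ∈ S → b ∉ S → a ≢ b
  ∈∉⇒≢ a∈S b∉S refl = b∉S a∈S

  nothing-outside⇒⊆ : ∀ {p q : Subset n} → ¬ (∃ λ a → a ∈ p × a ∉ q) → p ⊆ q
  nothing-outside⇒⊆ {q = q} none {a} a∈p with a ∈? q
  ... | yes a∈q = a∈q
  ... | no a∉q = contradiction (a , a∈p , a∉q) none

  ⊆-same-size⇒≡ : ∀ {p q : Subset n} → p ⊆ q → ∣ p ∣ ≡ ∣ q ∣ → p ≡ q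
  ⊆-same-size⇒≡ {p} {q} p⊆q same with any? (λ a → (a ∈? q) ×-dec ¬? (a ∈? p))
  ... | yes outside = contradiction same (<⇒≢ (p⊂q⇒∣p∣<∣q∣ (p⊆q , outside)))
  ... | no none = ⊆-antisym p⊆q (nothing-outside⇒⊆ none)

  element-outside : ∀ {p q : Subset n} → ∣ p ∣ ≡ ∣ q ∣ → p ≢ q → ∃ λ a → a ∈ p × a ∉ q
  element-outside {p} {q} same p≢q with any? (λ a → (a ∈? p) ×-dec ¬? (a ∈? q))
  ... | yes outside = outside
  ... | no none = contradiction (⊆-same-size⇒≡ (nothing-outside⇒⊆ none) same) p≢q


-- Consequences of girth ≥ 5: two edges share at most one vertex, and there is no
-- closed walk of length 3 or 4 through distinct vertices whose first two edges
-- differ (if later edges coincide, the walk collapses to a shorter one).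
module ShortCycles {n} (H : Hypergraph n) (girth : GirthAtLeast5 H) where

  private
    E : Fin (g H) → Subset n
    E = edge H

  common-edge-unique : ∀ {a b i j} → a ≢ b → a ∈ E i → b ∈ E i → a ∈ E j → b ∈ E j → i ≡ j
  common-edge-unique {a} {b} {i} {j} a≢b a∈i b∈i a∈j b∈j with i ≟ j
  ... | yes i≡j = i≡j
  ... | no i≢j = ⊥-elim (girth 1 (s≤s z≤n) (s≤s z≤n) digon)
    where
    digon : Cycle H 1
    digon = record
      { vtx = lookup (a ∷ b ∷ []) ; edg = lookup (i ∷ j ∷ [])
      ; vtx-inj = lookup-injective ((a≢b ∷ []) ∷ [] ∷ [])
      ; edg-inj = lookup-injective ((i≢j ∷ []) ∷ [] ∷ [])
      ; step = λ { zero → a∈i , b∈i } ; close = b∈j , a∈j }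

  no-triangle : ∀ {a b c i j l} → a ≢ b → a ≢ c → b ≢ c →
    a ∈ E i → b ∈ E i → b ∈ E j → c ∈ E j → c ∈ E l → a ∈ E l → i ≢ j → ⊥
  no-triangle {a} {b} {c} {i} {j} {l} a≢b a≢c b≢c a∈i b∈i b∈j c∈j c∈l a∈l i≢j
    with l ≟ i | l ≟ j
  ... | yes refl | _ = i≢j (common-edge-unique b≢c b∈i c∈l b∈j c∈j)
  ... | no _ | yes refl = i≢j (common-edge-unique a≢b a∈i b∈i a∈l b∈j)
  ... | no l≢i | no l≢j = girth 2 (s≤s z≤n) (s≤s (s≤s z≤n)) triangle
    where
    triangle : Cycle H 2
    triangle = record
      { vtx = lookup (a ∷ b ∷ c ∷ []) ; edg = lookup (i ∷ j ∷ l ∷ [])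
      ; vtx-inj = lookup-injective ((a≢b ∷ a≢c ∷ []) ∷ (b≢c ∷ []) ∷ [] ∷ [])
      ; edg-inj = lookup-injective ((i≢j ∷ ≢-sym l≢i ∷ []) ∷ (≢-sym l≢j ∷ []) ∷ [] ∷ [])
      ; step = λ { zero → a∈i , b∈i ; (suc zero) → b∈j , c∈j } ; close = c∈l , a∈l }

  no-quadrilateral : ∀ {a b c d i j l m} → a ≢ b → a ≢ c → a ≢ d → b ≢ c → b ≢ d → c ≢ d →
    a ∈ E i → b ∈ E i → b ∈ E j → c ∈ E j → c ∈ E l → d ∈ E l → d ∈ E m → a ∈ E m →
    i ≢ j → ⊥
  no-quadrilateral {a} {b} {c} {d} {i} {j} {l} {m} a≢b a≢c a≢d b≢c b≢d c≢d
                   a∈i b∈i b∈j c∈j c∈l d∈l d∈m a∈m i≢j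
    with j ≟ l | l ≟ m | i ≟ m | i ≟ l | j ≟ m
  ... | yes refl | _ | _ | _ | _ = no-triangle a≢b a≢d b≢d a∈i b∈i b∈j d∈l d∈m a∈m i≢j
  ... | no _ | yes refl | _ | _ | _ = no-triangle a≢b a≢c b≢c a∈i b∈i b∈j c∈j c∈l a∈m i≢j
  ... | no _ | no _ | yes refl | _ | _ =
    no-triangle (≢-sym b≢d) (≢-sym c≢d) b≢c d∈m b∈i b∈j c∈j c∈l d∈l i≢j
  ... | no _ | no _ | no _ | yes refl | _ = i≢j (common-edge-unique b≢c b∈i c∈l b∈j c∈j)
  ... | no _ | no _ | no _ | no _ | yes refl = i≢j (common-edge-unique a≢b a∈i b∈i a∈m b∈j)
  ... | no j≢l | no l≢m | no i≢m | no i≢l | no j≢m = girth 3 (s≤s z≤n) (s≤s (s≤s (s≤s z≤n))) quadrilateral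
    where
    quadrilateral : Cycle H 3
    quadrilateral = record
      { vtx = lookup (a ∷ b ∷ c ∷ d ∷ []) ; edg = lookup (i ∷ j ∷ l ∷ m ∷ [])
      ; vtx-inj = lookup-injective ((a≢b ∷ a≢c ∷ a≢d ∷ []) ∷ (b≢c ∷ b≢d ∷ []) ∷ (c≢d ∷ []) ∷ [] ∷ [])
      ; edg-inj = lookup-injective ((i≢j ∷ i≢l ∷ i≢m ∷ []) ∷ (j≢l ∷ j≢m ∷ []) ∷ (l≢m ∷ []) ∷ [] ∷ [])
      ; step = λ { zero → a∈i , b∈i ; (suc zero) → b∈j , c∈j ; (suc (suc zero)) → c∈l , d∈l }
      ; close = d∈m , a∈m }


value≡0⇒count≡0 : ∀ c k → (if c ≡ᵇ 0 then 0 else (if c ≡ᵇ k then k else 1)) ≡ 0 → c ≡ 0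
value≡0⇒count≡0 zero _ _ = refl
value≡0⇒count≡0 (suc c) zero ()
value≡0⇒count≡0 (suc c) (suc k) value≡0 with c ≡ᵇ k
value≡0⇒count≡0 (suc c) (suc k) () | true
value≡0⇒count≡0 (suc c) (suc k) () | false

count≡0⇒value≡0 : ∀ {c} k → c ≡ 0 → (if c ≡ᵇ 0 then 0 else (if c ≡ᵇ k then k else 1)) ≡ 0
count≡0⇒value≡0 _ refl = refl

same-detection⇒meets : ∀ {n k} (H : Hypergraph n) {B B' : Subset n} →
  detVector k H B ≡ detVector k H B' →
  ∀ {f a} → a ∈ edge H f → a ∈ B → Nonempty (edge H f ∩ B')
same-detection⇒meets {k = k} H {B} {B'} same {f} {a} a∈f a∈B =
  size≢0⇒nonempty λ misses-B' →
    nonempty⇒size≢0 (a , x∈p∩q⁺ (a∈f , a∈B))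
      (value≡0⇒count≡0 _ k (trans same-entry (count≡0⇒value≡0 k misses-B')))
  where
  entry : Subset _ → ℕ
  entry S = detValue k (edge H f) S
  same-entry : entry B ≡ entry B'
  same-entry = begin
    entry B                                                 ≡⟨ sym (lookup∘tabulate (λ i → detValue k (edge H i) B) f) ⟩
    Vec.lookup (detVector k H B) f                          ≡⟨ cong (λ vec → Vec.lookup vec f) same ⟩
    Vec.lookup (detVector k H B') f                         ≡⟨ lookup∘tabulate (λ i → detValue k (edge H i) B') f ⟩
    entry B'                                                ∎
    where open ≡-Reasoning


module Counting {n} (H : Hypergraph n) (girth : GirthAtLeast5 H)
  {k : ℕ} (k≥1 : 1 ≤ k) (degree-bound : ∀ a → k + 2 ≤ 2 * degree H a)
  (B B' : Subset n) (∣B∣≤k : ∣ B ∣ ≤ k)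
  (meets-B' : ∀ {f a} → a ∈ edge H f → a ∈ B → Nonempty (edge H f ∩ B'))
  (meets-B : ∀ {f a} → a ∈ edge H f → a ∈ B' → Nonempty (edge H f ∩ B))
  {v : Fin n} (v∈B : v ∈ B) (v∉B' : v ∉ B') where

  open ShortCycles H girth

  private
    E : Fin (g H) → Subset n
    E = edge H

  Choice : Set
  Choice = Fin (g H) → Fin n

  edgesAt : Fin n → List (Fin (g H))
  edgesAt a = filter (λ f → a ∈? E f) (allFin (g H))

  edgesAt-unique : ∀ a → Unique (edgesAt a)
  edgesAt-unique a = Uniqueₚ.filter⁺ (λ f → a ∈? E f) (Uniqueₚ.allFin⁺ (g H))

  ∈-edgesAt⁻ : ∀ {a f} → f ∈ˡ edgesAt a → a ∈ E f
  ∈-edgesAt⁻ {a} f∈ = proj₂ (∈-filter⁻ (λ f → a ∈? E f) {xs = allFin (g H)} f∈)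

  -- Every vertex lies on an edge other than any given one, as its degree is ≥ 2.
  -- Only this property of the witness is used, so it is kept abstract (which
  -- also stops the type checker from unfolding it).
  abstract
    another-edge : ∀ a f → ∃ λ f' → a ∈ E f' × f' ≢ f
    another-edge a f with avoid-one (edgesAt-unique a) (two-from-double k≥1 (degree-bound a)) f
    ... | f' , f'∈ , f'≢f = f' , ∈-edgesAt⁻ f'∈ , f'≢f

  along : Choice → Fin n → List (Fin n)
  along σ a = map σ (edgesAt a)

  along⁻ : ∀ {σ : Choice} {a y} → y ∈ˡ along σ a → ∃ λ f → a ∈ E f × y ≡ σ f
  along⁻ {σ} y∈ with ∈-map⁻ σ y∈
  ... | f , f∈ , y≡σf = f , ∈-edgesAt⁻ f∈ , y≡σf

  along-within : ∀ {σ : Choice} {a} {S : Subset n} → (∀ {f} → a ∈ E f → σ f ∈ S) → All (_∈ S) (along σ a)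
  along-within {S = S} σ∈S = All.tabulate λ y∈ →
    let (f , a∈f , y≡σf) = along⁻ y∈ in subst (_∈ S) (sym y≡σf) (σ∈S a∈f)

  along-unique : ∀ {σ : Choice} {a} → (∀ {f f'} → a ∈ E f → a ∈ E f' → σ f ≡ σ f' → f ≡ f') →
    Unique (along σ a)
  along-unique {σ} σ-inj =
    map-unique σ (λ f∈ f'∈ → σ-inj (∈-edgesAt⁻ f∈) (∈-edgesAt⁻ f'∈)) (edgesAt-unique _)

  -- Choosing on each edge through a a vertex other than a is injective (no 2-cycle).
  spoke-injective : ∀ {σ : Choice} {a} → (∀ {f} → a ∈ E f → σ f ∈ E f × σ f ≢ a) →
    ∀ {f f'} → a ∈ E f → a ∈ E f' → σ f ≡ σ f' → f ≡ f'
  spoke-injective {σ} σ-spoke {f} {f'} a∈f a∈f' σf≡σf' =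
    common-edge-unique (proj₂ (σ-spoke a∈f)) (proj₁ (σ-spoke a∈f)) a∈f
      (subst (_∈ E f') (sym σf≡σf') (proj₁ (σ-spoke a∈f'))) a∈f'

  -- Deg a + deg b ≥ k + 2 vertices of B, chosen along the edges through a and b
  -- and with at most one repetition, cannot fit into B.
  too-many : ∀ {σ τ : Choice} {a b} → Unique (along σ a) → Unique (along τ b) →
    (∀ {f} → a ∈ E f → σ f ∈ B) → (∀ {f} → b ∈ E f → τ f ∈ B) →
    AtMostOneCommon (along σ a) (along τ b) → ⊥
  too-many {σ} {τ} {a} {b} σ-unique τ-unique σ∈B τ∈B one = 1+n≰n (begin
    2 + k                                    ≡⟨ +-comm 2 k ⟩
    k + 2                                    ≤⟨ half-sum {k + 2} {degree H a} {degree H b} (degree-bound a) (degree-bound b) ⟩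
    degree H a + degree H b                  ≡⟨ sym (cong₂ _+_ (length-map σ (edgesAt a)) (length-map τ (edgesAt b))) ⟩
    length (along σ a) + length (along τ b)  ≤⟨ overlap-count σ-unique τ-unique (along-within σ∈B) (along-within τ∈B) one ⟩
    suc ∣ B ∣                                ≤⟨ s≤s ∣B∣≤k ⟩
    suc k                                    ∎)
    where open ≤-Reasoning

  toB toB' : Choice
  toB f = choose v (E f ∩ B)
  toB' f = choose v (E f ∩ B')

  toB-spec : ∀ {f a} → a ∈ E f → a ∈ B' → toB f ∈ E f × toB f ∈ B
  toB-spec {f} a∈f a∈B' = x∈p∩q⁻ (E f) B (choose-∈ v (meets-B a∈f a∈B'))

  toB'-spec : ∀ {f a} → a ∈ E f → a ∈ B → toB' f ∈ E f × toB' f ∈ B'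
  toB'-spec {f} a∈f a∈B = x∈p∩q⁻ (E f) B' (choose-∈ v (meets-B' a∈f a∈B))

  toB-spoke : ∀ {x} → x ∈ B' → x ∉ B → ∀ {f} → x ∈ E f → toB f ∈ E f × toB f ≢ x
  toB-spoke x∈B' x∉B x∈f = proj₁ (toB-spec x∈f x∈B') , ∈∉⇒≢ (proj₂ (toB-spec x∈f x∈B')) x∉B

  toB'-spoke : ∀ {f} → v ∈ E f → toB' f ∈ E f × toB' f ≢ v
  toB'-spoke v∈f = proj₁ (toB'-spec v∈f v∈B) , ∈∉⇒≢ (proj₂ (toB'-spec v∈f v∈B)) v∉B'

  toB'-at : ∀ {ε y} → v ∈ E ε → y ≡ toB' ε → y ∈ E ε × y ∈ B'
  toB'-at v∈ε refl = toB'-spec v∈ε v∈B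

  -- With the
  -- chosen B-vertices on the edges through x ∈ B' ∖ B we get two lists in B;
  -- two common elements y ≢ y' would close the 4-cycle y - x - y' - v.
  unmixed-impossible : ∀ {x} → x ∈ B' → x ∉ B → (∀ {ε} → v ∈ E ε → toB' ε ∈ B) → ⊥
  unmixed-impossible {x} x∈B' x∉B toB'∈B =
    too-many (along-unique (spoke-injective toB'-spoke))
             (along-unique (spoke-injective (toB-spoke x∈B' x∉B)))
             toB'∈B (λ x∈f → proj₂ (toB-spec x∈f x∈B')) at-most-one
    where
    at-most-one : AtMostOneCommon (along toB' v) (along toB x)
    at-most-one y∈ y'∈ y∈' y'∈' with along⁻ y∈ | along⁻ y'∈ | along⁻ y∈' | along⁻ y'∈'
    ... | f , x∈f , refl | f' , x∈f' , refl | ε , v∈ε , y≡w | ε' , v∈ε' , y'≡w'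
      with toB-spec x∈f x∈B' | toB-spec x∈f' x∈B' | toB'-at v∈ε y≡w | toB'-at v∈ε' y'≡w'
    ... | y∈f , y∈B | y'∈f' , y'∈B | y∈ε , y∈B' | y'∈ε' , y'∈B' with toB f ≟ toB f'
    ... | yes y≡y' = y≡y'
    ... | no y≢y' = ⊥-elim (no-quadrilateral
          (∈∉⇒≢ y∈B x∉B) y≢y' (∈∉⇒≢ y∈B' v∉B') (≢-sym (∈∉⇒≢ y'∈B x∉B))
          (∈∉⇒≢ x∈B' v∉B') (∈∉⇒≢ y'∈B' v∉B')
          y∈f x∈f x∈f' y'∈f' y'∈ε' v∈ε' v∈ε y∈ε
          (λ f≡f' → y≢y' (cong toB f≡f')))

  toB'-distinct : ∀ {ε ε'} → v ∈ E ε → v ∈ E ε' → ε ≢ ε' → toB' ε ≢ toB' ε'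
  toB'-distinct v∈ε v∈ε' ε≢ε' w≡w' = ε≢ε' (spoke-injective toB'-spoke v∈ε v∈ε' w≡w')

  detour : Fin (g H) → Fin (g H)
  detour ε = proj₁ (another-edge (toB' ε) ε)

  detour-spec : ∀ ε → toB' ε ∈ E (detour ε) × detour ε ≢ ε
  detour-spec ε = proj₂ (another-edge (toB' ε) ε)

  -- The chosen B-vertex on the detour of an edge ε through v; it differs from v,
  -- as otherwise v and toB' ε would share both ε and its detour.
  relayed : Choice
  relayed ε = toB (detour ε)

  relayed-spec : ∀ {ε} → v ∈ E ε → relayed ε ∈ E (detour ε) × relayed ε ∈ B × relayed ε ≢ v
  relayed-spec {ε} v∈ε =
    let (w∈ε , w≢v) = toB'-spoke v∈ε
        (w∈d , d≢ε) = detour-spec ε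
        (y∈d , y∈B) = toB-spec w∈d (proj₂ (toB'-spec v∈ε v∈B))
    in y∈d , y∈B , λ y≡v → d≢ε (common-edge-unique w≢v w∈d (subst (_∈ E (detour ε)) y≡v y∈d) w∈ε v∈ε)

  relay : Choice
  relay ε with toB' ε ∈? B
  ... | yes _ = toB' ε
  ... | no _ = relayed ε

  relay-view : ∀ ε → (relay ε ≡ toB' ε × toB' ε ∈ B) ⊎ (relay ε ≡ relayed ε × toB' ε ∉ B)
  relay-view ε with toB' ε ∈? B
  ... | yes w∈B = inj₁ (refl , w∈B)
  ... | no w∉B = inj₂ (refl , w∉B)

  relay-within : ∀ {ε} → v ∈ E ε → relay ε ∈ B
  relay-within {ε} v∈ε with relay-view ε
  ... | inj₁ (r≡w , w∈B) = subst (_∈ B) (sym r≡w) w∈B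
  ... | inj₂ (r≡y , _) = subst (_∈ B) (sym r≡y) (proj₁ (proj₂ (relayed-spec v∈ε)))

  -- A chosen B'-vertex equal to a relayed vertex forces equal edges; otherwise
  -- w' - v - w is a triangle through ε', ε and the detour of ε'.
  toB'≡relayed⇒same : ∀ {ε ε'} → v ∈ E ε → v ∈ E ε' → toB' ε ≡ relayed ε' → ε ≡ ε'
  toB'≡relayed⇒same {ε} {ε'} v∈ε v∈ε' w≡y' with ε ≟ ε'
  ... | yes ε≡ε' = ε≡ε'
  ... | no ε≢ε' =
    let (w∈ε , w≢v) = toB'-spoke v∈ε
        (w'∈ε' , w'≢v) = toB'-spoke v∈ε'
        (y'∈d' , _) = relayed-spec v∈ε'
    in ⊥-elim (no-triangle w'≢v (toB'-distinct v∈ε' v∈ε (≢-sym ε≢ε')) (≢-sym w≢v)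
                 w'∈ε' v∈ε' v∈ε w∈ε (subst (_∈ E (detour ε')) (sym w≡y') y'∈d')
                 (proj₁ (detour-spec ε')) (≢-sym ε≢ε'))

  -- Relayed vertices of edges whose B'-vertices lie outside B determine the edge;
  -- otherwise w' - v - w - y is a 4-cycle through ε', ε and the two detours.
  relayed-injective : ∀ {ε ε'} → v ∈ E ε → v ∈ E ε' → toB' ε ∉ B → toB' ε' ∉ B →
    relayed ε ≡ relayed ε' → ε ≡ ε'
  relayed-injective {ε} {ε'} v∈ε v∈ε' w∉B w'∉B y≡y' with ε ≟ ε'
  ... | yes ε≡ε' = ε≡ε'
  ... | no ε≢ε' =
    let (w∈ε , w≢v) = toB'-spoke v∈ε
        (w'∈ε' , w'≢v) = toB'-spoke v∈ε'
        (y∈d , y∈B , y≢v) = relayed-spec v∈ε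
        (y'∈d' , _) = relayed-spec v∈ε'
    in ⊥-elim (no-quadrilateral w'≢v (toB'-distinct v∈ε' v∈ε (≢-sym ε≢ε'))
                 (≢-sym (∈∉⇒≢ y∈B w'∉B)) (≢-sym w≢v) (≢-sym y≢v) (≢-sym (∈∉⇒≢ y∈B w∉B))
                 w'∈ε' v∈ε' v∈ε w∈ε (proj₁ (detour-spec ε)) y∈d
                 (subst (_∈ E (detour ε')) (sym y≡y') y'∈d') (proj₁ (detour-spec ε'))
                 (≢-sym ε≢ε'))

  relay-injective : ∀ {ε ε'} → v ∈ E ε → v ∈ E ε' → relay ε ≡ relay ε' → ε ≡ ε'
  relay-injective {ε} {ε'} v∈ε v∈ε' r≡r' with relay-view ε | relay-view ε'
  ... | inj₁ (r≡w , _) | inj₁ (r'≡w' , _) =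
    spoke-injective toB'-spoke v∈ε v∈ε' (trans (sym r≡w) (trans r≡r' r'≡w'))
  ... | inj₁ (r≡w , _) | inj₂ (r'≡y' , _) =
    toB'≡relayed⇒same v∈ε v∈ε' (trans (sym r≡w) (trans r≡r' r'≡y'))
  ... | inj₂ (r≡y , _) | inj₁ (r'≡w' , _) =
    sym (toB'≡relayed⇒same v∈ε' v∈ε (trans (sym r'≡w') (trans (sym r≡r') r≡y)))
  ... | inj₂ (r≡y , w∉B) | inj₂ (r'≡y' , w'∉B) =
    relayed-injective v∈ε v∈ε' w∉B w'∉B (trans (sym r≡y) (trans r≡r' r'≡y'))

  -- Let e hold v and some x ∈ B' ∖ B.  A chosen B-vertex on an edge through x can
  -- coincide with the relay of an edge ε through v only if ε = e: otherwise
  -- x - v - w closes a triangle (w ∈ B) or x - v - w - y a 4-cycle (w ∉ B).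
  relay-meets-only-along : ∀ {x e ε f} → x ∈ B' → x ∉ B → v ∈ E e → x ∈ E e →
    v ∈ E ε → x ∈ E f → toB f ≡ relay ε → ε ≡ e
  relay-meets-only-along {x} {e} {ε} {f} x∈B' x∉B v∈e x∈e v∈ε x∈f t≡r
    with ε ≟ e | relay-view ε
  ... | yes ε≡e | _ = ε≡e
  ... | no ε≢e | inj₁ (r≡w , w∈B) =
    let (w∈ε , w≢v) = toB'-spoke v∈ε
        x≢v = ∈∉⇒≢ x∈B' v∉B'
    in ⊥-elim (no-triangle x≢v (≢-sym (∈∉⇒≢ w∈B x∉B)) (≢-sym w≢v) x∈e v∈e v∈ε w∈ε
                 (subst (_∈ E f) (trans t≡r r≡w) (proj₁ (toB-spec x∈f x∈B'))) x∈f (≢-sym ε≢e))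
  ... | no ε≢e | inj₂ (r≡y , w∉B) =
    let (w∈ε , w≢v) = toB'-spoke v∈ε
        (y∈d , y∈B , y≢v) = relayed-spec v∈ε
        x≢v = ∈∉⇒≢ x∈B' v∉B'
        x≢w = λ x≡w → ε≢e (common-edge-unique (≢-sym x≢v) v∈ε (subst (_∈ E ε) (sym x≡w) w∈ε) v∈e x∈e)
    in ⊥-elim (no-quadrilateral x≢v x≢w (≢-sym (∈∉⇒≢ y∈B x∉B)) (≢-sym w≢v) (≢-sym y≢v)
                 (≢-sym (∈∉⇒≢ y∈B w∉B)) x∈e v∈e v∈ε w∈ε (proj₁ (detour-spec ε)) y∈d
                 (subst (_∈ E f) (trans t≡r r≡y) (proj₁ (toB-spec x∈f x∈B'))) x∈f (≢-sym ε≢e))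

  mixed-impossible : ∀ {x e} → x ∈ B' → x ∉ B → v ∈ E e → x ∈ E e → ⊥
  mixed-impossible {x} {e} x∈B' x∉B v∈e x∈e =
    too-many (along-unique (spoke-injective (toB-spoke x∈B' x∉B))) (along-unique relay-injective)
             (λ x∈f → proj₂ (toB-spec x∈f x∈B')) relay-within at-most-one
    where
    only-e : ∀ {y} → y ∈ˡ along relay v → y ∈ˡ along toB x → y ≡ relay e
    only-e y∈r y∈t with along⁻ y∈r | along⁻ y∈t
    ... | ε , v∈ε , refl | f , x∈f , r≡t =
      cong relay (relay-meets-only-along x∈B' x∉B v∈e x∈e v∈ε x∈f (sym r≡t))
    at-most-one : AtMostOneCommon (along toB x) (along relay v)
    at-most-one y∈ y'∈ y∈' y'∈' = trans (only-e y∈ y∈') (sym (only-e y'∈ y'∈'))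

  -- Hence B' ∖ B is empty: either case applies, the second one to an edge
  -- through v whose chosen B'-vertex lies outside B.
  B'∖B-empty : ∀ {x} → x ∈ B' → x ∉ B → ⊥
  B'∖B-empty x∈B' x∉B with any? (λ ε → (v ∈? E ε) ×-dec ¬? (toB' ε ∈? B))
  ... | yes (ε , v∈ε , w∉B) =
    let (w∈ε , w∈B') = toB'-spec v∈ε v∈B in mixed-impossible w∈B' w∉B v∈ε w∈ε
  ... | no none = unmixed-impossible x∈B' x∉B toB'∈B
    where
    toB'∈B : ∀ {ε} → v ∈ E ε → toB' ε ∈ B
    toB'∈B {ε} v∈ε with toB' ε ∈? B
    ... | yes w∈B = w∈B
    ... | no w∉B = contradiction (ε , v∈ε , w∉B) none


mainTheorem8 : ∀ (k : ℕ) → 1 ≤ k → ∀ {n} (H : Hypergraph n) → Uniform k H →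
  (∀ (v : Fin n) → k + 2 ≤ 2 * degree H v) → GirthAtLeast5 H →
  ∀ (k' : ℕ) → 1 ≤ k' → k' ≤ k → Detectable k k' H
mainTheorem8 k k≥1 H _ degree-bound girth k' _ k'≤k B B' ∣B∣≡k' ∣B'∣≡k' B≢B' same =
  let (v , v∈B , v∉B') = element-outside (trans ∣B∣≡k' (sym ∣B'∣≡k')) B≢B'
      (x , x∈B' , x∉B) = element-outside (trans ∣B'∣≡k' (sym ∣B∣≡k')) (≢-sym B≢B')
      ∣B∣≤k = subst (_≤ k) (sym ∣B∣≡k') k'≤k
  in Counting.B'∖B-empty H girth k≥1 degree-bound B B' ∣B∣≤k
       (same-detection⇒meets H same) (same-detection⇒meets H (sym same)) v∈B v∉B' x∈B' x∉B
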